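{- Let $\mathcal{A}$ be a linearly ordered alphabet of cardinality $2$. For every integer $n \geqslant 3$, there exists a word $w \in \mathcal{A}^{3 \times 2^n-2}$ on which the IS-algorithm performs $n-1$ recursive calls, and such that \[|\mathsf{is}^k(w)|+1 = 2^{1-k} (|w|+2) / 3\] for all $k \in \{1,2,\ldots,n-1\}$.
   Context: Words are indexed from $0$: $w = w_0 \cdots w_{|w|-1}$, and $w_{i \cdots j} = w_i \cdots w_j$. A sentinel letter $\$ \notin \mathcal{A}$ is smaller than every letter of $\mathcal{A}$, and $w_{|w|} = \$$. An integer $i \leqslant |w|-1$ is $w$-non-decreasing if there is $j$ with $i+1 \leqslant j \leqslant |w|-1$ and $w_i = \cdots = w_{j-1} < w_j$; it is $w$-locally minimal if moreover $i \geqslant 1$ and $w_{i-1} > w_i$. If $i_0 < \cdots < i_{k-1}$ are the $w$-locally minimal integers and $i_k = |w|$, the unimodal factors of $w$ are $w_{i_0 \cdots i_1}, \ldots, w_{i_{k-1} \cdots i_k}$; $\mathsf{eis}(w)$ is the length-$k$ word over the lexicographically ordered alphabet $\mathcal{A}^+\cdot(\varepsilon+\$)$ whose letters are these factors in order; $\mathsf{is}(w)$ is obtained from $\mathsf{eis}(w)$ by replacing each letter by its rank (from $0$) among the distinct letters of $\mathsf{eis}(w)$; $\mathsf{is}^0(w)=w$, $\mathsf{is}^{k+1}(w) = \mathsf{is}(\mathsf{is}^k(w))$. The IS-algorithm computes the suffix array of its input word $v$ by computing $\mathsf{is}(v)$ and then computing the suffix array of $\mathsf{is}(v)$, directly if the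 letters of $\mathsf{is}(v)$ are pairwise distinct, and by a recursive call of the IS-algorithm on $\mathsf{is}(v)$ otherwise. -}

module Defs where

open import Data.Nat using (ℕ; zero; suc; _+_; _∸_; _≡ᵇ_; _<ᵇ_; _≤ᵇ_)
open import Data.Bool using (Bool; true; false; _∧_; not; if_then_else_)
open import Data.List using (List; []; _∷_; _++_; map; length; take; drop; upTo)
open import Data.Bool.ListAction using (any; all)
open import Data.Maybe using (Maybe; just; nothing)

-- Words over an ordered alphabet are represented as lists of naturals
-- (the order on letters is the order of ℕ).  Words are indexed from 0.

-- w_i for 0 ≤ i < |w| (default 0 outside; only used in range)
at : List ℕ → ℕ → ℕ
at []       _       = 0
at (x ∷ xs) zero    = x
at (x ∷ xs) (suc i) = at xs i

range : ℕ → ℕ → List ℕ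
range a b = map (a +_) (upTo (b ∸ a))

filterᵇ : {A : Set} → (A → Bool) → List A → List A
filterᵇ p []       = []
filterᵇ p (x ∷ xs) = if p x then x ∷ filterᵇ p xs else filterᵇ p xs

nonDecreasing : List ℕ → ℕ → Bool
nonDecreasing w i =
  any (λ j → ((suc i) ≤ᵇ j) ∧ (j ≤ᵇ (length w ∸ 1))
             ∧ all (λ m → at w m ≡ᵇ at w i) (range i j)
             ∧ (at w i <ᵇ at w j))
      (upTo (length w))

locallyMinimal : List ℕ → ℕ → Bool
locallyMinimal w i =
  (i ≤ᵇ (length w ∸ 1)) ∧ nonDecreasing w i ∧ (1 ≤ᵇ i) ∧ (at w i <ᵇ at w (i ∸ 1))

locMins : List ℕ → List ℕ
locMins w = filterᵇ (locallyMinimal w) (upTo (length w))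

-- letters of A ∪ {$}: nothing = $ (smallest), just a = a
Letter$ : Set
Letter$ = Maybe ℕ

ext : List ℕ → List Letter$
ext w = map just w ++ (nothing ∷ [])

-- the factor w_{i ⋯ j} = w_i ⋯ w_j (inclusive, possibly ending with $)
factor : List ℕ → ℕ → ℕ → List Letter$
factor w i j = take (suc (j ∸ i)) (drop i (ext w))

eisAux : List ℕ → List ℕ → List (List Letter$)
eisAux w (a ∷ b ∷ r) = factor w a b ∷ eisAux w (b ∷ r)
eisAux w _           = []

eis : List ℕ → List (List Letter$)
eis w = eisAux w (locMins w ++ (length w ∷ []))

letterLt : Letter$ → Letter$ → Bool
letterLt nothing  nothing  = false
letterLt nothing  (just _) = true
letterLt (just _) nothing  = false
letterLt (just a) (just b) = a <ᵇ b

letterEq : Letter$ → Letter$ → Bool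
letterEq nothing  nothing  = true
letterEq nothing  (just _) = false
letterEq (just _) nothing  = false
letterEq (just a) (just b) = a ≡ᵇ b

lexLt : List Letter$ → List Letter$ → Bool
lexLt []       []       = false
lexLt []       (_ ∷ _)  = true
lexLt (_ ∷ _)  []       = false
lexLt (x ∷ xs) (y ∷ ys) =
  if letterLt x y then true else (if letterEq x y then lexLt xs ys else false)

wordEq : List Letter$ → List Letter$ → Bool
wordEq []       []       = true
wordEq []       (_ ∷ _)  = false
wordEq (_ ∷ _)  []       = false
wordEq (x ∷ xs) (y ∷ ys) = letterEq x y ∧ wordEq xs ys

dedup : List (List Letter$) → List (List Letter$)
dedup []       = []
dedup (x ∷ xs) = x ∷ filterᵇ (λ y → not (wordEq x y)) (dedup xs)

-- rank (from 0) of f among the distinct letters of fs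
rank : List (List Letter$) → List Letter$ → ℕ
rank fs f = length (dedup (filterᵇ (λ g → lexLt g f) fs))

is : List ℕ → List ℕ
is w = map (rank (eis w)) (eis w)

isPow : ℕ → List ℕ → List ℕ
isPow zero    w = w
isPow (suc k) w = is (isPow k w)

-- A block word over t = x₁ ⋯ xₖ is 1 · B(x₁) ⋯ B(xₖ), each block B(x) a 0 followed by a run of a
-- positive letter. Its locally minimal positions are exactly its zeros, so its unimodal factors are
-- the blocks, each closed by the 0 of the next block or by $. When blocks compare lexicographically
-- as their letters do, the last letter of t occurs only there, and t contains all letters below each
-- of its letters, the factor of xᵢ has rank xᵢ: is maps the block word over t back to t.
-- The shapes B(x) = 0 (x+1) and B(x) = 0 1^(x+1) both qualify. Iterating the first on
-- tower 1 = 2020201 gives words with is (tower (k+1)) = tower k (for k = 0, tower 0 = 110) and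
-- |tower k| + 1 = 2^(k+2). The binary block word over tower (n−2) has length 3·2ⁿ − 2; its k-th image
-- under is is tower (n−1−k), which repeats a letter, and is (110) is empty.

module Submission where

open import Defs
open import Data.Nat
  using (ℕ; zero; suc; _+_; _*_; _∸_; _^_; _<_; _≤_; _≡ᵇ_; _<ᵇ_; _≤ᵇ_; z≤n; s≤s; z<s; s<s)
open import Data.Nat.Properties
  using (_≟_; <-cmp; ≤-refl; ≤-trans; <⇒≤; <⇒≢; ≤∧≢⇒<; ≤-pred; n<1+n; m<n⇒m<1+n;
         suc[m]≤n⇒m≤pred[n];
         suc-injective; +-suc; +-comm; +-identityʳ; *-assoc; ^-distribˡ-+-*;
         m+n∸n≡m; m+[n∸m]≡n; m∸n+n≡m; [m+n]∸[m+o]≡n∸o; n∸n≡0)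
open import Data.Nat.ListAction using (sum)
open import Data.Nat.Tactic.RingSolver using (solve-∀)
open import Data.Bool using (Bool; true; false; not; _∧_; if_then_else_)
open import Data.Bool.Properties using (∧-zeroʳ; ∨-zeroʳ)
open import Data.Bool.ListAction using (any; all)
open import Data.Fin using (Fin; toℕ) renaming (zero to 0F; suc to sucF)
open import Data.List using (List; []; _∷_; _++_; map; length; replicate; concatMap; take; drop; upTo; applyUpTo)
open import Data.List.Properties
  using (length-map; length-++; length-replicate; map-∘; map-++; map-id; map-id-local; map-cong;
         ++-assoc; map-upTo; map-concatMap; concatMap-cong; map-replicate)
open import Data.List.Membership.Propositional using (_∈_)
open import Data.List.Membership.Propositional.Properties using (∈-upTo⁺; ∈-upTo⁻)
open import Data.List.Membership.DecPropositional _≟_ using (_∈?_)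
open import Data.List.Relation.Unary.All using (All; all?; []; _∷_)
import Data.List.Relation.Unary.All as All
import Data.List.Relation.Unary.All.Properties as All
open import Data.List.Relation.Unary.AllPairs using ([]; _∷_)
open import Data.List.Relation.Unary.Any using (here; there)
open import Data.List.Relation.Unary.Linked using (Linked; [-]; _∷_)
open import Data.List.Relation.Unary.Unique.Propositional using (Unique)
open import Data.Maybe using (just; nothing)
open import Data.Product using (∃-syntax; _×_; _,_; proj₂)
open import Data.Sum using (_⊎_; inj₁; inj₂)
open import Function using (_∘_)
open import Relation.Binary using (tri<; tri≈; tri>)
open import Relation.Binary.PropositionalEquality
open import Relation.Nullary using (¬_; contradiction)
open import Relation.Nullary.Decidable using (True; toWitness)
open ≡-Reasoning

≡ᵇ-refl : ∀ m → (m ≡ᵇ m) ≡ true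
≡ᵇ-refl zero    = refl
≡ᵇ-refl (suc m) = ≡ᵇ-refl m

≡ᵇ-sound : ∀ m n → (m ≡ᵇ n) ≡ true → m ≡ n
≡ᵇ-sound zero    zero    _ = refl
≡ᵇ-sound (suc m) (suc n) e = cong suc (≡ᵇ-sound m n e)

≢⇒≡ᵇ-false : ∀ {m n} → m ≢ n → (m ≡ᵇ n) ≡ false
≢⇒≡ᵇ-false {m} {n} m≢n with m ≡ᵇ n in e
... | true  = contradiction (≡ᵇ-sound m n e) m≢n
... | false = refl

<⇒<ᵇ-true : ∀ {m n} → m < n → (m <ᵇ n) ≡ true
<⇒<ᵇ-true (s≤s z≤n)       = refl
<⇒<ᵇ-true (s≤s (s≤s m<n)) = <⇒<ᵇ-true (s≤s m<n)

≤⇒<ᵇ-false : ∀ {m n} → n ≤ m → (m <ᵇ n) ≡ false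
≤⇒<ᵇ-false z≤n               = refl
≤⇒<ᵇ-false {suc m} (s≤s n≤m) = ≤⇒<ᵇ-false n≤m

<ᵇ-sound : ∀ m n → (m <ᵇ n) ≡ true → m < n
<ᵇ-sound zero    (suc n) _ = z<s
<ᵇ-sound (suc m) (suc n) e = s<s (<ᵇ-sound m n e)

not-true⇒false : ∀ {b} → not b ≡ true → b ≡ false
not-true⇒false {false} _ = refl

_≢ᵇ_ : ℕ → ℕ → Bool
m ≢ᵇ n = not (m ≡ᵇ n)

<ᵇ-irrefl : ∀ m → (m <ᵇ m) ≡ false
<ᵇ-irrefl zero    = refl
<ᵇ-irrefl (suc m) = <ᵇ-irrefl m

≤⇒≤ᵇ-true : ∀ {m n} → m ≤ n → (m ≤ᵇ n) ≡ true
≤⇒≤ᵇ-true {zero}  _   = refl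
≤⇒≤ᵇ-true {suc m} m<n = <⇒<ᵇ-true m<n

≢ᵇ-true : ∀ {m n} → m ≢ n → (m ≢ᵇ n) ≡ true
≢ᵇ-true m≢n = cong not (≢⇒≡ᵇ-false m≢n)

≢ᵇ-sound : ∀ m n → (m ≢ᵇ n) ≡ true → m ≢ n
≢ᵇ-sound m n e refl = contradiction (trans (sym (not-true⇒false e)) (≡ᵇ-refl m)) λ ()

module _ {A : Set} where

  filterᵇ-accept : ∀ (p : A → Bool) {x} xs → p x ≡ true → filterᵇ p (x ∷ xs) ≡ x ∷ filterᵇ p xs
  filterᵇ-accept p xs e rewrite e = refl

  filterᵇ-reject : ∀ (p : A → Bool) {x} xs → p x ≡ false → filterᵇ p (x ∷ xs) ≡ filterᵇ p xs
  filterᵇ-reject p xs e rewrite e = refl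

  filterᵇ-comm : ∀ (p q : A → Bool) xs → filterᵇ p (filterᵇ q xs) ≡ filterᵇ q (filterᵇ p xs)
  filterᵇ-comm p q [] = refl
  filterᵇ-comm p q (x ∷ xs) with p x in px | q x in qx
  ... | true  | true  rewrite px | qx = cong (x ∷_) (filterᵇ-comm p q xs)
  ... | true  | false rewrite qx = filterᵇ-comm p q xs
  ... | false | true  rewrite px = filterᵇ-comm p q xs
  ... | false | false = filterᵇ-comm p q xs

  filterᵇ-cong : ∀ {p q : A → Bool} xs → (∀ {x} → x ∈ xs → p x ≡ q x) → filterᵇ p xs ≡ filterᵇ q xs
  filterᵇ-cong [] _ = refl
  filterᵇ-cong {p} {q} (x ∷ xs) p≗q with q x in qx
  ... | true  = trans (filterᵇ-accept p xs (trans (p≗q (here refl)) qx))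
                      (cong (x ∷_) (filterᵇ-cong xs (p≗q ∘ there)))
  ... | false = trans (filterᵇ-reject p xs (trans (p≗q (here refl)) qx)) (filterᵇ-cong xs (p≗q ∘ there))

  ∈-filterᵇ⁺ : ∀ (p : A → Bool) {x xs} → x ∈ xs → p x ≡ true → x ∈ filterᵇ p xs
  ∈-filterᵇ⁺ p {xs = y ∷ xs} (here refl) px rewrite px = here refl
  ∈-filterᵇ⁺ p {xs = y ∷ xs} (there x∈) px with p y
  ... | true  = there (∈-filterᵇ⁺ p x∈ px)
  ... | false = ∈-filterᵇ⁺ p x∈ px

  ∈-filterᵇ⁻ : ∀ (p : A → Bool) {x} xs → x ∈ filterᵇ p xs → x ∈ xs × p x ≡ true
  ∈-filterᵇ⁻ p (y ∷ xs) x∈ with p y in py | x∈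
  ... | true  | here refl = here refl , py
  ... | true  | there x∈′ = let x∈xs , px = ∈-filterᵇ⁻ p xs x∈′ in there x∈xs , px
  ... | false | x∈′       = let x∈xs , px = ∈-filterᵇ⁻ p xs x∈′ in there x∈xs , px

  filterᵇ-all : ∀ {p : A → Bool} xs → (∀ {x} → x ∈ xs → p x ≡ true) → filterᵇ p xs ≡ xs
  filterᵇ-all [] _ = refl
  filterᵇ-all {p} (x ∷ xs) all-p =
    trans (filterᵇ-accept p xs (all-p (here refl))) (cong (x ∷_) (filterᵇ-all xs (all-p ∘ there)))

  filterᵇ-none : ∀ {p : A → Bool} xs → (∀ {x} → x ∈ xs → p x ≡ false) → filterᵇ p xs ≡ []
  filterᵇ-none [] _ = refl
  filterᵇ-none {p} (x ∷ xs) no-p = trans (filterᵇ-reject p xs (no-p (here refl))) (filterᵇ-none xs (no-p ∘ there))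

  filterᵇ-map : ∀ {B : Set} (p : B → Bool) (f : A → B) xs →
                filterᵇ p (map f xs) ≡ map f (filterᵇ (λ x → p (f x)) xs)
  filterᵇ-map p f [] = refl
  filterᵇ-map p f (x ∷ xs) with p (f x)
  ... | true  = cong (f x ∷_) (filterᵇ-map p f xs)
  ... | false = filterᵇ-map p f xs

any-∈ : ∀ {A : Set} (p : A → Bool) {x xs} → x ∈ xs → p x ≡ true → any p xs ≡ true
any-∈ p (here refl) px rewrite px = refl
any-∈ p {xs = y ∷ _} (there x∈) px rewrite any-∈ p x∈ px = ∨-zeroʳ (p y)

dedupℕ : List ℕ → List ℕ
dedupℕ []       = []
dedupℕ (x ∷ xs) = x ∷ filterᵇ (x ≢ᵇ_) (dedupℕ xs)

filterᵇ-≢ᵇ-rejected : ∀ (p : ℕ → Bool) {x} xs → p x ≡ false →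
                      filterᵇ p (filterᵇ (x ≢ᵇ_) xs) ≡ filterᵇ p xs
filterᵇ-≢ᵇ-rejected p {x} xs px = trans (filterᵇ-comm p (x ≢ᵇ_) xs) (filterᵇ-all (filterᵇ p xs) x≢)
  where
  x≢ : ∀ {y} → y ∈ filterᵇ p xs → (x ≢ᵇ y) ≡ true
  x≢ y∈ with ∈-filterᵇ⁻ p xs y∈
  ... | _ , py = ≢ᵇ-true {x} λ { refl → contradiction (trans (sym px) py) λ () }

filterᵇ-dedupℕ : ∀ (p : ℕ → Bool) xs → filterᵇ p (dedupℕ xs) ≡ dedupℕ (filterᵇ p xs)
filterᵇ-dedupℕ p [] = refl
filterᵇ-dedupℕ p (x ∷ xs) with p x in px
... | true  = cong (x ∷_) (begin
  filterᵇ p (filterᵇ (x ≢ᵇ_) (dedupℕ xs)) ≡⟨ filterᵇ-comm p (x ≢ᵇ_) (dedupℕ xs) ⟩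
  filterᵇ (x ≢ᵇ_) (filterᵇ p (dedupℕ xs)) ≡⟨ cong (filterᵇ (x ≢ᵇ_)) (filterᵇ-dedupℕ p xs) ⟩
  filterᵇ (x ≢ᵇ_) (dedupℕ (filterᵇ p xs)) ∎)
... | false = trans (filterᵇ-≢ᵇ-rejected p (dedupℕ xs) px) (filterᵇ-dedupℕ p xs)

length-filterᵇ-≡ᵇ-≢ᵇ : ∀ a xs →
                       length xs ≡ length (filterᵇ (a ≡ᵇ_) xs) + length (filterᵇ (a ≢ᵇ_) xs)
length-filterᵇ-≡ᵇ-≢ᵇ a [] = refl
length-filterᵇ-≡ᵇ-≢ᵇ a (x ∷ xs) with a ≡ᵇ x
... | true  = cong suc (length-filterᵇ-≡ᵇ-≢ᵇ a xs)
... | false = trans (cong suc (length-filterᵇ-≡ᵇ-≢ᵇ a xs)) (sym (+-suc _ _))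

filterᵇ-≡ᵇ-dedupℕ : ∀ {a xs} → a ∈ xs → filterᵇ (a ≡ᵇ_) (dedupℕ xs) ≡ a ∷ []
filterᵇ-≡ᵇ-dedupℕ {a} {x ∷ xs} a∈ with a ≡ᵇ x in a≡ᵇx | a∈
... | true  | _ rewrite ≡ᵇ-sound a x a≡ᵇx =
  cong (x ∷_) (filterᵇ-none (filterᵇ (x ≢ᵇ_) (dedupℕ xs))
                λ y∈ → not-true⇒false (proj₂ (∈-filterᵇ⁻ (x ≢ᵇ_) (dedupℕ xs) y∈)))
... | false | here refl = contradiction (trans (sym a≡ᵇx) (≡ᵇ-refl a)) λ ()
... | false | there a∈xs =
  trans (filterᵇ-≢ᵇ-rejected (a ≡ᵇ_) (dedupℕ xs) a≡ᵇx) (filterᵇ-≡ᵇ-dedupℕ a∈xs)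

length-dedupℕ : ∀ {a xs} → a ∈ xs → length (dedupℕ xs) ≡ suc (length (dedupℕ (filterᵇ (a ≢ᵇ_) xs)))
length-dedupℕ {a} {xs} a∈ = begin
  length (dedupℕ xs)
    ≡⟨ length-filterᵇ-≡ᵇ-≢ᵇ a (dedupℕ xs) ⟩
  length (filterᵇ (a ≡ᵇ_) (dedupℕ xs)) + length (filterᵇ (a ≢ᵇ_) (dedupℕ xs))
    ≡⟨ cong₂ (λ u v → length u + length v) (filterᵇ-≡ᵇ-dedupℕ a∈) (filterᵇ-dedupℕ (a ≢ᵇ_) xs) ⟩
  suc (length (dedupℕ (filterᵇ (a ≢ᵇ_) xs))) ∎

length-dedupℕ-initialSegment : ∀ n xs → (∀ {x} → x ∈ xs → x < n) → (∀ {x} → x < n → x ∈ xs) →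
                      length (dedupℕ xs) ≡ n
length-dedupℕ-initialSegment zero [] _ _ = refl
length-dedupℕ-initialSegment zero (x ∷ xs) bound _ with () ← bound (here refl)
length-dedupℕ-initialSegment (suc n) xs bound cover =
  trans (length-dedupℕ (cover (n<1+n n))) (cong suc (length-dedupℕ-initialSegment n _ bound′ cover′))
  where
  bound′ : ∀ {x} → x ∈ filterᵇ (n ≢ᵇ_) xs → x < n
  bound′ x∈ with x∈xs , n≢ᵇx ← ∈-filterᵇ⁻ (n ≢ᵇ_) xs x∈ =
    ≤∧≢⇒< (≤-pred (bound x∈xs)) (≢ᵇ-sound n _ n≢ᵇx ∘ sym)
  cover′ : ∀ {x} → x < n → x ∈ filterᵇ (n ≢ᵇ_) xs
  cover′ x<n = ∈-filterᵇ⁺ (n ≢ᵇ_) (cover (m<n⇒m<1+n x<n)) (≢ᵇ-true (<⇒≢ x<n ∘ sym))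

DownClosed : List ℕ → Set
DownClosed t = ∀ {a b} → a ∈ t → b < a → b ∈ t

rankℕ : List ℕ → ℕ → ℕ
rankℕ t x = length (dedupℕ (filterᵇ (_<ᵇ x) t))

rankℕ-downClosed : ∀ {t x} → DownClosed t → x ∈ t → rankℕ t x ≡ x
rankℕ-downClosed {t} {x} closed x∈ = length-dedupℕ-initialSegment x _ bound cover
  where
  bound : ∀ {y} → y ∈ filterᵇ (_<ᵇ x) t → y < x
  bound y∈ = <ᵇ-sound _ x (proj₂ (∈-filterᵇ⁻ (_<ᵇ x) t y∈))
  cover : ∀ {y} → y < x → y ∈ filterᵇ (_<ᵇ x) t
  cover y<x = ∈-filterᵇ⁺ (_<ᵇ x) (closed x∈ y<x) (<⇒<ᵇ-true y<x)

letterLt-irrefl : ∀ a → letterLt a a ≡ false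
letterLt-irrefl nothing  = refl
letterLt-irrefl (just m) = <ᵇ-irrefl m

letterEq-refl : ∀ a → letterEq a a ≡ true
letterEq-refl nothing  = refl
letterEq-refl (just m) = ≡ᵇ-refl m

letterEq-sound : ∀ a b → letterEq a b ≡ true → a ≡ b
letterEq-sound nothing  nothing  _ = refl
letterEq-sound (just m) (just n) e = cong just (≡ᵇ-sound m n e)

letterLt-asym : ∀ a b → letterLt a b ≡ true → letterLt b a ≡ false
letterLt-asym nothing  (just n) _ = refl
letterLt-asym (just m) (just n) e = ≤⇒<ᵇ-false (<⇒≤ (<ᵇ-sound m n e))

letterLt⇒letterEq-false : ∀ a b → letterLt a b ≡ true → letterEq b a ≡ false
letterLt⇒letterEq-false a b a<b with letterEq b a in b=a
... | false = refl
... | true rewrite letterEq-sound b a b=a = contradiction (trans (sym a<b) (letterLt-irrefl a)) λ ()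

lexLt-irrefl : ∀ u → lexLt u u ≡ false
lexLt-irrefl []      = refl
lexLt-irrefl (a ∷ u) rewrite letterLt-irrefl a | letterEq-refl a = lexLt-irrefl u

lexLt-≡ : ∀ {u v} → u ≡ v → lexLt u v ≢ true
lexLt-≡ {u} refl e = contradiction (trans (sym e) (lexLt-irrefl u)) λ ()

wordEq-refl : ∀ u → wordEq u u ≡ true
wordEq-refl []      = refl
wordEq-refl (a ∷ u) rewrite letterEq-refl a = wordEq-refl u

wordEq-sound : ∀ u v → wordEq u v ≡ true → u ≡ v
wordEq-sound []      []      _ = refl
wordEq-sound (a ∷ u) (b ∷ v) e with letterEq a b in ab
... | true = cong₂ _∷_ (letterEq-sound a b ab) (wordEq-sound u v e)

lexLt-asym : ∀ u v → lexLt u v ≡ true → lexLt v u ≡ false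
lexLt-asym []      (_ ∷ _) _ = refl
lexLt-asym (a ∷ u) (b ∷ v) e with letterLt a b in a<b | letterEq a b in a=b
... | true  | _ rewrite letterLt-asym a b a<b | letterLt⇒letterEq-false a b a<b = refl
... | false | true rewrite letterEq-sound a b a=b | letterLt-irrefl b | letterEq-refl b = lexLt-asym u v e

LexIncreasing : (ℕ → List Letter$) → Set
LexIncreasing h = ∀ {x y} → x < y → lexLt (h x) (h y) ≡ true

module _ {h : ℕ → List Letter$} (increasing : LexIncreasing h) where

  lexLt-increasing : ∀ x y → lexLt (h x) (h y) ≡ (x <ᵇ y)
  lexLt-increasing x y with <-cmp x y
  ... | tri< x<y _ _  = trans (increasing x<y) (sym (<⇒<ᵇ-true x<y))
  ... | tri≈ _ refl _ = trans (lexLt-irrefl (h x)) (sym (<ᵇ-irrefl x))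
  ... | tri> _ _ y<x  = trans (lexLt-asym (h y) (h x) (increasing y<x)) (sym (≤⇒<ᵇ-false (<⇒≤ y<x)))

  increasing-injective : ∀ {x y} → h x ≡ h y → x ≡ y
  increasing-injective {x} {y} hx≡hy with <-cmp x y
  ... | tri< x<y _ _ = contradiction (increasing x<y) (lexLt-≡ hx≡hy)
  ... | tri≈ _ x≡y _ = x≡y
  ... | tri> _ _ y<x = contradiction (increasing y<x) (lexLt-≡ (sym hx≡hy))

  wordEq-increasing : ∀ x y → wordEq (h x) (h y) ≡ (x ≡ᵇ y)
  wordEq-increasing x y with wordEq (h x) (h y) in e
  ... | true  rewrite increasing-injective (wordEq-sound (h x) (h y) e) = sym (≡ᵇ-refl y)
  ... | false = sym (≢⇒≡ᵇ-false {x} {y} λ { refl → contradiction (trans (sym e) (wordEq-refl (h x))) λ () })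

  dedup-map : ∀ xs → dedup (map h xs) ≡ map h (dedupℕ xs)
  dedup-map []       = refl
  dedup-map (x ∷ xs) = cong (h x ∷_) (begin
    filterᵇ (λ u → not (wordEq (h x) u)) (dedup (map h xs))
      ≡⟨ cong (filterᵇ _) (dedup-map xs) ⟩
    filterᵇ (λ u → not (wordEq (h x) u)) (map h (dedupℕ xs))
      ≡⟨ filterᵇ-map _ h (dedupℕ xs) ⟩
    map h (filterᵇ (λ y → not (wordEq (h x) (h y))) (dedupℕ xs))
      ≡⟨ cong (map h) (filterᵇ-cong (dedupℕ xs) λ {y} _ → cong not (wordEq-increasing x y)) ⟩
    map h (filterᵇ (x ≢ᵇ_) (dedupℕ xs)) ∎)

  rank-map : ∀ t x → rank (map h t) (h x) ≡ rankℕ t x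
  rank-map t x = begin
    length (dedup (filterᵇ (λ u → lexLt u (h x)) (map h t)))
      ≡⟨ cong (length ∘ dedup) (filterᵇ-map _ h t) ⟩
    length (dedup (map h (filterᵇ (λ y → lexLt (h y) (h x)) t)))
      ≡⟨ cong (length ∘ dedup ∘ map h) (filterᵇ-cong t λ {y} _ → lexLt-increasing y x) ⟩
    length (dedup (map h (filterᵇ (_<ᵇ x) t)))
      ≡⟨ cong length (dedup-map (filterᵇ (_<ᵇ x) t)) ⟩
    length (map h (dedupℕ (filterᵇ (_<ᵇ x) t)))
      ≡⟨ length-map h (dedupℕ (filterᵇ (_<ᵇ x) t)) ⟩
    rankℕ t x ∎

at-positive⇒< : ∀ w i → 0 < at w i → i < length w
at-positive⇒< (x ∷ w) zero    _   = s≤s z≤n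
at-positive⇒< (x ∷ w) (suc i) pos = s≤s (at-positive⇒< w i pos)

nonDecreasing-ascent : ∀ w i → at w i < at w (suc i) → nonDecreasing w i ≡ true
nonDecreasing-ascent w i ascent = any-∈ _ (∈-upTo⁺ si<∣w∣) witness
  where
  si<∣w∣ : suc i < length w
  si<∣w∣ = at-positive⇒< w (suc i) (≤-trans (s≤s z≤n) ascent)
  witness : ((suc i ≤ᵇ suc i) ∧ (suc i ≤ᵇ length w ∸ 1)
             ∧ all (λ m → at w m ≡ᵇ at w i) (range i (suc i)) ∧ (at w i <ᵇ at w (suc i))) ≡ true
  witness rewrite ≤⇒≤ᵇ-true (≤-refl {suc i}) | ≤⇒≤ᵇ-true (suc[m]≤n⇒m≤pred[n] si<∣w∣)
                | m+n∸n≡m 1 i | +-identityʳ i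
                | ≡ᵇ-refl (at w i) | <⇒<ᵇ-true ascent = refl

-- Along w ++ [0] a letter can drop only to 0, and every 0 is followed by a positive letter.
ValleyStep : ℕ → ℕ → Set
ValleyStep a zero    = 0 < a
ValleyStep a (suc b) = a ≤ suc b

Valley : List ℕ → Set
Valley w = 0 < at w 0 × Linked ValleyStep (w ++ 0 ∷ [])

valleyStep-at : ∀ w → Linked ValleyStep (w ++ 0 ∷ []) → ∀ i → i < length w →
                ValleyStep (at w i) (at w (suc i))
valleyStep-at (x ∷ [])    (step ∷ _)  zero    _         = step
valleyStep-at (x ∷ y ∷ w) (step ∷ _)  zero    _         = step
valleyStep-at (x ∷ y ∷ w) (_ ∷ steps) (suc i) (s≤s i<n) = valleyStep-at (y ∷ w) steps i i<n
valleyStep-at (x ∷ [])    _           (suc i) (s≤s ())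

locallyMinimal-no-descent : ∀ w i → (at w i <ᵇ at w (i ∸ 1)) ≡ false → locallyMinimal w i ≡ false
locallyMinimal-no-descent w i no-descent
  rewrite no-descent | ∧-zeroʳ (1 ≤ᵇ i) | ∧-zeroʳ (nonDecreasing w i) | ∧-zeroʳ (i ≤ᵇ length w ∸ 1) = refl

locallyMinimal-floor : ∀ w i → 0 < at w i → at w (suc i) ≡ 0 → 0 < at w (suc (suc i)) →
                       locallyMinimal w (suc i) ≡ true
locallyMinimal-floor w i left floor right
  rewrite ≤⇒≤ᵇ-true (<⇒≤ (suc[m]≤n⇒m≤pred[n] (at-positive⇒< w (suc (suc i)) right)))
        | nonDecreasing-ascent w (suc i) (subst (_< at w (suc (suc i))) (sym floor) right)
        | floor | <⇒<ᵇ-true left = refl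

locallyMinimal-valley : ∀ w → Valley w → ∀ i → i < length w → locallyMinimal w i ≡ (at w i ≡ᵇ 0)
locallyMinimal-valley w (head>0 , _) zero _ =
  trans (locallyMinimal-no-descent w 0 (<ᵇ-irrefl (at w 0))) (sym (positive-≡ᵇ0 head>0))
  where
  positive-≡ᵇ0 : ∀ {a} → 0 < a → (a ≡ᵇ 0) ≡ false
  positive-≡ᵇ0 {suc _} _ = refl
locallyMinimal-valley w (_ , steps) (suc i) si<∣w∣ = by-value (at w (suc i)) refl
  where
  step : ValleyStep (at w i) (at w (suc i))
  step = valleyStep-at w steps i (<⇒≤ si<∣w∣)
  after-zero : ∀ {b} → ValleyStep 0 b → 0 < b
  after-zero {suc _} _ = s≤s z≤n
  by-value : ∀ a → at w (suc i) ≡ a → locallyMinimal w (suc i) ≡ (at w (suc i) ≡ᵇ 0)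
  by-value zero e = trans
    (locallyMinimal-floor w i (subst (ValleyStep (at w i)) e step) e
      (after-zero (subst (λ a → ValleyStep a (at w (suc (suc i)))) e (valleyStep-at w steps (suc i) si<∣w∣))))
    (sym (cong (_≡ᵇ 0) e))
  by-value (suc c) e = trans
    (locallyMinimal-no-descent w (suc i)
      (subst (λ a → (a <ᵇ at w i) ≡ false) (sym e) (≤⇒<ᵇ-false (subst (ValleyStep (at w i)) e step))))
    (sym (cong (_≡ᵇ 0) e))

positions : (ℕ → Bool) → List ℕ → List ℕ
positions p []       = []
positions p (x ∷ xs) = if p x then 0 ∷ map suc (positions p xs) else map suc (positions p xs)

filterᵇ-upTo-suc : ∀ (p : ℕ → Bool) n →
                   filterᵇ p (applyUpTo suc n) ≡ map suc (filterᵇ (λ i → p (suc i)) (upTo n))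
filterᵇ-upTo-suc p n = trans (cong (filterᵇ p) (sym (map-upTo suc n))) (filterᵇ-map p suc (upTo n))

filterᵇ-upTo-at : ∀ (p : ℕ → Bool) w → filterᵇ (λ i → p (at w i)) (upTo (length w)) ≡ positions p w
filterᵇ-upTo-at p []       = refl
filterᵇ-upTo-at p (x ∷ xs) with p x
... | true  = cong (0 ∷_) (trans (filterᵇ-upTo-suc _ (length xs)) (cong (map suc) (filterᵇ-upTo-at p xs)))
... | false = trans (filterᵇ-upTo-suc _ (length xs)) (cong (map suc) (filterᵇ-upTo-at p xs))

zeros : List ℕ → List ℕ
zeros = positions (_≡ᵇ 0)

locMins-valley : ∀ w → Valley w → locMins w ≡ zeros w
locMins-valley w valley = trans
  (filterᵇ-cong (upTo (length w)) λ i∈ → locallyMinimal-valley w valley _ (∈-upTo⁻ i∈))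
  (filterᵇ-upTo-at (_≡ᵇ 0) w)

positions-++ : ∀ (p : ℕ → Bool) {ys} zs → All (λ y → p y ≡ false) ys →
               positions p (ys ++ zs) ≡ map (length ys +_) (positions p zs)
positions-++ p zs []                 = sym (map-id (positions p zs))
positions-++ p zs (py ∷ pys) rewrite py =
  trans (cong (map suc) (positions-++ p zs pys)) (sym (map-∘ (positions p zs)))

drop-ext-++ : ∀ ys zs a → drop (length ys + a) (ext (ys ++ zs)) ≡ drop a (ext zs)
drop-ext-++ []       zs a = refl
drop-ext-++ (y ∷ ys) zs a = drop-ext-++ ys zs a

factor-++ : ∀ ys zs a b → factor (ys ++ zs) (length ys + a) (length ys + b) ≡ factor zs a b
factor-++ ys zs a b rewrite [m+n]∸[m+o]≡n∸o (length ys) b a | drop-ext-++ ys zs a = refl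

eisAux-++ : ∀ ys zs cuts → eisAux (ys ++ zs) (map (length ys +_) cuts) ≡ eisAux zs cuts
eisAux-++ ys zs []              = refl
eisAux-++ ys zs (a ∷ [])        = refl
eisAux-++ ys zs (a ∷ b ∷ cuts)  = cong₂ _∷_ (factor-++ ys zs a b) (eisAux-++ ys zs (b ∷ cuts))

-- Stated with `+ 0`, the form in which the first cut of a block comes out of `cuts`.
factor-prefix : ∀ ys zs → factor (ys ++ zs) 0 (length ys + 0) ≡ map just ys ++ take 1 (ext zs)
factor-prefix []       zs = refl
factor-prefix (y ∷ ys) zs = cong (just y ∷_) (factor-prefix ys zs)

data Closing : Letter$ → Set where
  zero-closing : Closing (just 0)
  end-closing  : Closing nothing

-- The letter closing the unimodal factor of the block of x when L is the last letter:
-- the 0 opening the next block, or $.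
terminal : ℕ → ℕ → Letter$
terminal L x = if x ≡ᵇ L then nothing else just 0

terminal-last : ∀ L → terminal L L ≡ nothing
terminal-last L rewrite ≡ᵇ-refl L = refl

terminal-≢ : ∀ {L x} → x ≢ L → terminal L x ≡ just 0
terminal-≢ x≢L rewrite ≢⇒≡ᵇ-false x≢L = refl

terminal-closing : ∀ L x → Closing (terminal L x)
terminal-closing L x with x ≡ᵇ L
... | true  = end-closing
... | false = zero-closing

data UniqueLast (L : ℕ) : List ℕ → Set where
  last : UniqueLast L (L ∷ [])
  _∷_ : ∀ {x xs} → x ≢ L → UniqueLast L xs → UniqueLast L (x ∷ xs)

module BlockWords (width height : ℕ → ℕ) where

  block : ℕ → List ℕ
  block x = 0 ∷ replicate (suc (width x)) (suc (height x))

  blocks : List ℕ → List ℕ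
  blocks = concatMap block

  blockWord : List ℕ → List ℕ
  blockWord t = 1 ∷ blocks t

  blockFactor : Letter$ → ℕ → List Letter$
  blockFactor c x = map just (block x) ++ c ∷ []

  unimodalFactor : ℕ → ℕ → List Letter$
  unimodalFactor L x = blockFactor (terminal L x) x

  BlockOrder : Set
  BlockOrder = ∀ {c d x y} → Closing c → x < y → lexLt (blockFactor c x) (blockFactor d y) ≡ true

  run-valley : ∀ n c rest → Linked ValleyStep (suc c ∷ rest) →
               Linked ValleyStep (replicate (suc n) (suc c) ++ rest)
  run-valley zero    c rest steps = steps
  run-valley (suc n) c rest steps = ≤-refl ∷ run-valley n c rest steps

  blocks-valley : ∀ {a} t → 0 < a → Linked ValleyStep (a ∷ blocks t ++ 0 ∷ [])
  blocks-valley []      a>0 = a>0 ∷ [-]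
  blocks-valley (x ∷ t) a>0 rewrite ++-assoc (replicate (suc (width x)) (suc (height x))) (blocks t) (0 ∷ []) =
    a>0 ∷ z≤n ∷ run-valley (width x) (height x) _ (blocks-valley t (s≤s z≤n))

  blockWord-valley : ∀ t → Valley (blockWord t)
  blockWord-valley t = s≤s z≤n , blocks-valley t (s≤s z≤n)

  cuts : List ℕ → List ℕ
  cuts []      = 0 ∷ []
  cuts (x ∷ t) = 0 ∷ map (length (block x) +_) (cuts t)

  zeros-blocks : ∀ t → zeros (blocks t) ++ length (blocks t) ∷ [] ≡ cuts t
  zeros-blocks []      = refl
  zeros-blocks (x ∷ t) = cong (0 ∷_) (begin
    map suc (zeros (run ++ blocks t)) ++ length (block x ++ blocks t) ∷ []
      ≡⟨ cong₂ (λ ps n → map suc ps ++ n ∷ []) run-free (length-++ (block x)) ⟩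
    map suc (map (length run +_) (zeros (blocks t))) ++ shift (length (blocks t) ∷ [])
      ≡⟨ cong (_++ shift (length (blocks t) ∷ [])) (sym (map-∘ (zeros (blocks t)))) ⟩
    shift (zeros (blocks t)) ++ shift (length (blocks t) ∷ [])
      ≡⟨ sym (map-++ (length (block x) +_) (zeros (blocks t)) _) ⟩
    shift (zeros (blocks t) ++ length (blocks t) ∷ [])
      ≡⟨ cong shift (zeros-blocks t) ⟩
    shift (cuts t) ∎)
    where
    run = replicate (suc (width x)) (suc (height x))
    shift : List ℕ → List ℕ
    shift = map (length (block x) +_)
    run-free : zeros (run ++ blocks t) ≡ map (length run +_) (zeros (blocks t))
    run-free = positions-++ (_≡ᵇ 0) (blocks t) (All.replicate⁺ (suc (width x)) refl)

  eisAux-blocks : ∀ {L t} → UniqueLast L t → eisAux (blocks t) (cuts t) ≡ map (unimodalFactor L) t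
  eisAux-blocks {L} last = cong (_∷ [])
    (trans (factor-prefix (block L) []) (cong (λ c → blockFactor c L) (sym (terminal-last L))))
  eisAux-blocks {L} {x ∷ y ∷ t} (x≢L ∷ rest) = cong₂ _∷_
    (trans (factor-prefix (block x) (blocks (y ∷ t))) (cong (λ c → blockFactor c x) (sym (terminal-≢ x≢L))))
    (trans (eisAux-++ (block x) (blocks (y ∷ t)) (cuts (y ∷ t))) (eisAux-blocks rest))

  eis-blockWord : ∀ {L t} → UniqueLast L t → eis (blockWord t) ≡ map (unimodalFactor L) t
  eis-blockWord {L} {t} ul = begin
    eisAux (blockWord t) (locMins (blockWord t) ++ length (blockWord t) ∷ [])
      ≡⟨ cong (λ ms → eisAux (blockWord t) (ms ++ length (blockWord t) ∷ [])) locMins-blockWord ⟩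
    eisAux (blockWord t) (map suc (zeros (blocks t)) ++ map suc (length (blocks t) ∷ []))
      ≡⟨ cong (eisAux (blockWord t)) (sym (map-++ suc (zeros (blocks t)) _)) ⟩
    eisAux (blockWord t) (map suc (zeros (blocks t) ++ length (blocks t) ∷ []))
      ≡⟨ cong (eisAux (blockWord t) ∘ map suc) (zeros-blocks t) ⟩
    eisAux (blockWord t) (map suc (cuts t))
      ≡⟨ eisAux-++ (1 ∷ []) (blocks t) (cuts t) ⟩
    eisAux (blocks t) (cuts t)
      ≡⟨ eisAux-blocks ul ⟩
    map (unimodalFactor L) t ∎
    where
    locMins-blockWord : locMins (blockWord t) ≡ map suc (zeros (blocks t))
    locMins-blockWord = locMins-valley (blockWord t) (blockWord-valley t)

  is-blockWord : BlockOrder → ∀ {L t} → UniqueLast L t → DownClosed t → is (blockWord t) ≡ t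
  is-blockWord order {L} {t} ul closed rewrite eis-blockWord ul = begin
    map (rank (map h t)) (map h t)      ≡⟨ sym (map-∘ t) ⟩
    map (λ x → rank (map h t) (h x)) t  ≡⟨ map-cong (rank-map increasing t) t ⟩
    map (rankℕ t) t                     ≡⟨ map-id-local (All.tabulate (rankℕ-downClosed closed)) ⟩
    t                                   ∎
    where
    h : ℕ → List Letter$
    h = unimodalFactor L
    increasing : LexIncreasing h
    increasing {x} x<y = order (terminal-closing L x) x<y

-- Doubling.block x = 0 (x+1) and Binary.block x = 0 1^(x+1).
module Doubling = BlockWords (λ _ → 0) (λ x → x)
module Binary   = BlockWords (λ x → x) (λ _ → 0)

doubling-order : Doubling.BlockOrder
doubling-order _ x<y rewrite <⇒<ᵇ-true x<y = refl

ones-lexLt : ∀ {c d m n} → Closing c → m < n →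
             lexLt (map just (replicate m 1) ++ c ∷ []) (map just (replicate n 1) ++ d ∷ []) ≡ true
ones-lexLt zero-closing (s≤s z≤n)       = refl
ones-lexLt end-closing  (s≤s z≤n)       = refl
ones-lexLt c            (s≤s (s≤s m<n)) = ones-lexLt c (s≤s m<n)

binary-order : Binary.BlockOrder
binary-order c x<y = ones-lexLt c (s≤s x<y)

downClosed-by-decision : ∀ t → True (all? (λ a → all? (_∈? t) (upTo a)) t) → DownClosed t
downClosed-by-decision t ok a∈ b<a = All.lookup (All.lookup (toWitness ok) a∈) (∈-upTo⁺ b<a)

∈-doubling⁻ : ∀ {a t} → a ∈ Doubling.blocks t → a ≡ 0 ⊎ ∃[ c ] a ≡ suc c × c ∈ t
∈-doubling⁻ {t = x ∷ t} (here refl)         = inj₁ refl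
∈-doubling⁻ {t = x ∷ t} (there (here refl)) = inj₂ (x , refl , here refl)
∈-doubling⁻ {t = x ∷ t} (there (there a∈)) with ∈-doubling⁻ a∈
... | inj₁ a≡0            = inj₁ a≡0
... | inj₂ (c , a≡c+1 , c∈) = inj₂ (c , a≡c+1 , there c∈)

∈-doubling⁺ : ∀ {c t} → c ∈ t → suc c ∈ Doubling.blocks t
∈-doubling⁺ (here refl) = there (here refl)
∈-doubling⁺ (there c∈)  = there (there (∈-doubling⁺ c∈))

doubling-downClosed : ∀ {x t} → DownClosed (x ∷ t) → DownClosed (Doubling.blockWord (x ∷ t))
doubling-downClosed closed (here refl) (s≤s z≤n) = there (here refl)
doubling-downClosed {x} {t} closed (there a∈) b<a with ∈-doubling⁻ {t = x ∷ t} a∈ | b<a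
... | inj₂ (c , refl , c∈) | s≤s z≤n       = there (here refl)
... | inj₂ (c , refl , c∈) | s≤s (s≤s d<c) = there (∈-doubling⁺ {t = x ∷ t} (closed c∈ (s≤s d<c)))

doubling-uniqueLast : ∀ {L t} → UniqueLast L t → UniqueLast (suc L) (Doubling.blocks t)
doubling-uniqueLast last          = (λ ()) ∷ last
doubling-uniqueLast (x≢L ∷ rest) = (λ ()) ∷ (x≢L ∘ suc-injective) ∷ doubling-uniqueLast rest

length-doubling : ∀ t → length (Doubling.blocks t) ≡ length t + length t
length-doubling []      = refl
length-doubling (x ∷ t) = cong suc (trans (cong suc (length-doubling t)) (sym (+-suc (length t) (length t))))

sum-doubling : ∀ t → sum (Doubling.blocks t) ≡ length t + sum t
sum-doubling []      = refl
sum-doubling (x ∷ t) = trans (cong (suc x +_) (sum-doubling t)) (swap x (length t) (sum t))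
  where
  swap : ∀ x l s → suc x + (l + s) ≡ suc l + (x + s)
  swap = solve-∀

length-binary : ∀ t → length (Binary.blocks t) ≡ length t + length t + sum t
length-binary []      = refl
length-binary (x ∷ t) = begin
  suc (length (replicate (suc x) 1 ++ Binary.blocks t))  ≡⟨ cong suc (length-++ (replicate (suc x) 1)) ⟩
  suc (length (replicate (suc x) 1) + length (Binary.blocks t))
    ≡⟨ cong₂ (λ r b → suc (r + b)) (length-replicate (suc x)) (length-binary t) ⟩
  suc (suc x + (length t + length t + sum t))             ≡⟨ regroup x (length t) (sum t) ⟩
  suc (length t) + suc (length t) + (x + sum t)           ∎
  where
  regroup : ∀ x l s → suc (suc x + (l + l + s)) ≡ suc l + suc l + (x + s)
  regroup = solve-∀

-- tower 1 starts with 2 so that its letters sum to its length (tower-sum), which fixes |word m|.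
tower : ℕ → List ℕ
tower 0             = 1 ∷ 1 ∷ 0 ∷ []
tower 1             = 2 ∷ 0 ∷ 2 ∷ 0 ∷ 2 ∷ 0 ∷ 1 ∷ []
tower (suc (suc k)) = Doubling.blockWord (tower (suc k))

tower-uniqueLast : ∀ k → UniqueLast (suc k) (tower (suc k))
tower-uniqueLast zero    = (λ ()) ∷ (λ ()) ∷ (λ ()) ∷ (λ ()) ∷ (λ ()) ∷ (λ ()) ∷ last
tower-uniqueLast (suc k) = (λ ()) ∷ doubling-uniqueLast (tower-uniqueLast k)

tower-∷∷ : ∀ k → ∃[ x ] ∃[ y ] ∃[ t ] tower (suc k) ≡ x ∷ y ∷ t
tower-∷∷ zero = _ , _ , _ , refl
tower-∷∷ (suc k) with tower (suc k) | tower-∷∷ k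
... | _ | _ , _ , _ , refl = _ , _ , _ , refl

tower-downClosed : ∀ k → DownClosed (tower k)
tower-downClosed 0             = downClosed-by-decision (tower 0) _
tower-downClosed 1             = downClosed-by-decision (tower 1) _
tower-downClosed (suc (suc k)) with tower (suc k) | tower-∷∷ k | tower-downClosed (suc k)
... | _ | _ , _ , _ , refl | closed = doubling-downClosed closed

is-tower : ∀ k → is (tower (suc k)) ≡ tower k
is-tower zero    = refl
is-tower (suc k) = Doubling.is-blockWord doubling-order (tower-uniqueLast k) (tower-downClosed (suc k))

tower-notUnique : ∀ k → ¬ Unique (tower k)
tower-notUnique 0 ((1≢1 ∷ _) ∷ _) = 1≢1 refl
tower-notUnique 1 ((_ ∷ 2≢2 ∷ _) ∷ _) = 2≢2 refl
tower-notUnique (suc (suc k)) with tower (suc k) | tower-∷∷ k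
... | _ | _ , _ , _ , refl = λ { (_ ∷ (_ ∷ 0≢0 ∷ _) ∷ _) → 0≢0 refl }

tower-length : ∀ k → length (tower k) + 1 ≡ 2 ^ (2 + k)
tower-length 0             = refl
tower-length 1             = refl
tower-length (suc (suc k)) = begin
  suc (length (Doubling.blocks t)) + 1 ≡⟨ cong (λ n → suc n + 1) (length-doubling t) ⟩
  suc (length t + length t) + 1        ≡⟨ double (length t) ⟩
  2 * (length t + 1)                   ≡⟨ cong (2 *_) (tower-length (suc k)) ⟩
  2 ^ (2 + suc (suc k))                ∎
  where
  t = tower (suc k)
  double : ∀ l → suc (l + l) + 1 ≡ 2 * (l + 1)
  double = solve-∀

tower-sum : ∀ k → sum (tower (suc k)) ≡ length (tower (suc k))
tower-sum zero    = refl
tower-sum (suc k) = cong suc (begin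
  sum (Doubling.blocks t)   ≡⟨ sum-doubling t ⟩
  length t + sum t          ≡⟨ cong (length t +_) (tower-sum k) ⟩
  length t + length t       ≡⟨ sym (length-doubling t) ⟩
  length (Doubling.blocks t) ∎)
  where
  t = tower (suc k)

binaryWord : List ℕ → List (Fin 2)
binaryWord t = 1F ∷ concatMap (λ x → 0F ∷ replicate (suc x) 1F) t
  where
  1F : Fin 2
  1F = sucF 0F

toℕ-binaryWord : ∀ t → map toℕ (binaryWord t) ≡ Binary.blockWord t
toℕ-binaryWord t = cong (1 ∷_) (trans (map-concatMap toℕ _ t)
  (concatMap-cong (λ x → cong (0 ∷_) (map-replicate toℕ (suc x) (sucF 0F))) t))

isPow-suc : ∀ k w → isPow (suc k) w ≡ isPow k (is w)
isPow-suc zero    w = refl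
isPow-suc (suc k) w = cong is (isPow-suc k w)

isPow-tower : ∀ j i → isPow j (tower (j + i)) ≡ tower i
isPow-tower zero    i = refl
isPow-tower (suc j) i = trans (isPow-suc j _) (trans (cong (isPow j) (is-tower (j + i))) (isPow-tower j i))

word : ℕ → List (Fin 2)
word m = binaryWord (tower (suc m))

is-word : ∀ m → is (map toℕ (word m)) ≡ tower (suc m)
is-word m = trans (cong is (toℕ-binaryWord (tower (suc m))))
  (Binary.is-blockWord binary-order (tower-uniqueLast m) (tower-downClosed (suc m)))

isPow-word : ∀ m j → j ≤ suc m → isPow (suc j) (map toℕ (word m)) ≡ tower (suc m ∸ j)
isPow-word m j j≤ = begin
  isPow (suc j) (map toℕ (word m))  ≡⟨ isPow-suc j _ ⟩
  isPow j (is (map toℕ (word m)))   ≡⟨ cong (isPow j) (is-word m) ⟩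
  isPow j (tower (suc m))           ≡⟨ cong (isPow j ∘ tower) (sym (m+[n∸m]≡n j≤)) ⟩
  isPow j (tower (j + (suc m ∸ j))) ≡⟨ isPow-tower j (suc m ∸ j) ⟩
  tower (suc m ∸ j)                 ∎

length-word : ∀ m → length (word m) + 2 ≡ 3 * 2 ^ (3 + m)
length-word m = begin
  length (word m) + 2
    ≡⟨ cong (_+ 2) (trans (sym (length-map toℕ (word m))) (cong length (toℕ-binaryWord t))) ⟩
  suc (length (Binary.blocks t)) + 2        ≡⟨ cong (λ n → suc n + 2) (length-binary t) ⟩
  suc (length t + length t + sum t) + 2     ≡⟨ cong (λ s → suc (length t + length t + s) + 2) (tower-sum m) ⟩
  suc (length t + length t + length t) + 2  ≡⟨ triple (length t) ⟩
  3 * (length t + 1)                        ≡⟨ cong (3 *_) (tower-length (suc m)) ⟩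
  3 * 2 ^ (3 + m)                           ∎
  where
  t = tower (suc m)
  triple : ∀ l → suc (l + l + l) + 2 ≡ 3 * (l + 1)
  triple = solve-∀

pow-split : ∀ {j n} → j ≤ n → 2 ^ j * 2 ^ (2 + (n ∸ j)) ≡ 2 ^ (2 + n)
pow-split {j} {n} j≤n = trans (sym (^-distribˡ-+-* 2 j (2 + (n ∸ j))))
  (cong (2 ^_) (trans (+-comm j (2 + (n ∸ j))) (cong (2 +_) (m∸n+n≡m j≤n))))

scaled-length-tower : ∀ {m j} → j ≤ suc m →
                      3 * 2 ^ j * (length (tower (suc m ∸ j)) + 1) ≡ length (word m) + 2
scaled-length-tower {m} {j} j≤ = begin
  3 * 2 ^ j * (length (tower (suc m ∸ j)) + 1)  ≡⟨ cong (3 * 2 ^ j *_) (tower-length (suc m ∸ j)) ⟩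
  3 * 2 ^ j * 2 ^ (2 + (suc m ∸ j))             ≡⟨ *-assoc 3 (2 ^ j) _ ⟩
  3 * (2 ^ j * 2 ^ (2 + (suc m ∸ j)))           ≡⟨ cong (3 *_) (pow-split j≤) ⟩
  3 * 2 ^ (3 + m)                               ≡⟨ sym (length-word m) ⟩
  length (word m) + 2                           ∎

corollary5 : (n : ℕ) → 3 ≤ n →
    ∃[ w ] (length {A = Fin 2} w ≡ 3 * 2 ^ n ∸ 2)
      × (∀ k → 1 ≤ k → k ≤ n ∸ 1 → ¬ Unique (isPow k (map toℕ w)))
      × Unique (isPow n (map toℕ w))
      × (∀ k → 1 ≤ k → k ≤ n ∸ 1 →
           3 * 2 ^ (k ∸ 1) * (length (isPow k (map toℕ w)) + 1) ≡ length w + 2)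
corollary5 (suc (suc (suc m))) (s≤s (s≤s (s≤s _))) = word m , length-eq , not-unique , unique , lengths
  where
  length-eq : length (word m) ≡ 3 * 2 ^ (3 + m) ∸ 2
  length-eq = trans (sym (m+n∸n≡m (length (word m)) 2)) (cong (_∸ 2) (length-word m))
  not-unique : ∀ k → 1 ≤ k → k ≤ suc (suc m) → ¬ Unique (isPow k (map toℕ (word m)))
  not-unique (suc j) _ (s≤s j≤) rewrite isPow-word m j j≤ = tower-notUnique (suc m ∸ j)
  unique : Unique (is (isPow (suc (suc m)) (map toℕ (word m))))
  unique rewrite isPow-word m (suc m) ≤-refl | n∸n≡0 m = []
  lengths : ∀ k → 1 ≤ k → k ≤ suc (suc m) →
            3 * 2 ^ (k ∸ 1) * (length (isPow k (map toℕ (word m))) + 1) ≡ length (word m) + 2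
  lengths (suc j) _ (s≤s j≤) rewrite isPow-word m j j≤ = scaled-length-tower j≤
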